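{- Let $P,Q\in\mathbb{Z}[x]$ be two polynomials of degree at most $3$ and let $\mathcal{F}_k: y^2=P(x)k+Q(x)$. For every prime power $q$ we have $$\#M(\mathbb{F}_q)=q^3+q^2+\tilde{M}_{2,q}(\mathcal{F}_k).$$
   Context: For $q=p^r$ the polynomials are reduced mod $p$. For $k\in\mathbb{F}_q$ let $a_{k,q}=q-\#\{(x,y)\in\mathbb{F}_q^2: y^2=P(x)k+Q(x)\}$ and $a_{\infty,q}=q-\#\{(x,y)\in\mathbb{F}_q^2: y^2=P(x)\}$; $\tilde{M}_{2,q}(\mathcal{F}_k)=\sum_{k\in\mathbb{F}_q}a_{k,q}^2+a_{\infty,q}^2$. The threefold $M$ is the union of $M_{aff}:(P(x_1)k+Q(x_1))(P(x_2)k+Q(x_2))=y^2$ in $\mathbb{A}^4_{x_1,x_2,k,y}$ (placed over $(k:1)\in\mathbb{P}^1$) and $M_\infty: P(x_1)P(x_2)=y^2$ in $\mathbb{A}^3_{x_1,x_2,y}$ (placed over $(1:0)\in\mathbb{P}^1$), inside $\mathbb{A}^1\times\mathbb{A}^1\times\mathbb{P}^1\times\mathbb{A}^1$; thus $\#M(\mathbb{F}_q)=\#\{(x_1,x_2,k,y)\in\mathbb{F}_q^4:(P(x_1)k+Q(x_1))(P(x_2)k+Q(x_2))=y^2\}+\#\{(x_1,x_2,y)\in\mathbb{F}_q^3:P(x_1)P(x_2)=y^2\}$. -}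

module Defs where

open import Data.Nat using (ℕ; zero; suc; _≤_)
open import Data.Integer as ℤ using (ℤ; +_; -[1+_])
open import Data.List using (List; []; _∷_; length; sum; map)
open import Data.List.Membership.Propositional using (_∈_)
open import Data.List.Relation.Unary.Unique.Propositional using (Unique)
open import Data.Product using (Σ; _×_)
open import Relation.Nullary using (¬_; Dec; yes; no)
open import Relation.Binary.PropositionalEquality using (_≡_)
open import Algebra.Structures using (IsCommutativeRing)

-- Its order q = length elements is a prime power, and every prime power
-- arises this way; so "for every prime power q, over F_q" is rendered as
-- "for every finite field F".
record FiniteField : Set₁ where
  field
    Carrier  : Set
    _+_ _*_  : Carrier → Carrier → Carrier
    -_       : Carrier → Carrier
    0# 1#    : Carrier
    isCommutativeRing : IsCommutativeRing _≡_ _+_ _*_ -_ 0# 1#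
    0≢1      : ¬ (0# ≡ 1#)
    inverse  : (x : Carrier) → ¬ (x ≡ 0#) → Σ Carrier (λ y → x * y ≡ 1#)
    _≟_      : (x y : Carrier) → Dec (x ≡ y)
    elements : List Carrier
    complete : (x : Carrier) → x ∈ elements
    unique   : Unique elements

  order : ℕ
  order = length elements

  ℕ→F : ℕ → Carrier
  ℕ→F zero = 0#
  ℕ→F (suc n) = 1# + ℕ→F n

  ℤ→F : ℤ → Carrier
  ℤ→F (+ n) = ℕ→F n
  ℤ→F -[1+ n ] = - (ℕ→F (suc n))

  -- integer polynomial given by its coefficient list [c₀, c₁, …],
  -- evaluated (after reduction mod p) at x ∈ F, by Horner's rule
  eval : List ℤ → Carrier → Carrier
  eval [] x = 0#
  eval (c ∷ cs) x = ℤ→F c + (x * eval cs x)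

  countEq : {A : Set} → List A → (A → Carrier) → (A → Carrier) → ℕ
  countEq [] f g = 0
  countEq (a ∷ as) f g with f a ≟ g a
  ... | yes _ = suc (countEq as f g)
  ... | no  _ = countEq as f g

  pairs : List (Carrier × Carrier)
  pairs = Data.List.concatMap (λ x → map (λ y → (x Data.Product., y)) elements) elements

DegLe : List ℤ → ℕ → Set
DegLe cs d = length cs ≤ suc d

module _ (F : FiniteField) (P Q : List ℤ) where
  open FiniteField F
  open Data.Product using (_,_; proj₁; proj₂)

  q : ℤ
  q = + order

  Nk : Carrier → ℕ
  Nk k = countEq pairs (λ xy → proj₂ xy * proj₂ xy)
                       (λ xy → (eval P (proj₁ xy) * k) + eval Q (proj₁ xy))

  N∞ : ℕ
  N∞ = countEq pairs (λ xy → proj₂ xy * proj₂ xy) (λ xy → eval P (proj₁ xy))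

  a : Carrier → ℤ
  a k = q ℤ.- (+ Nk k)

  a∞ : ℤ
  a∞ = q ℤ.- (+ N∞)

  M̃₂ : ℤ
  M̃₂ = Data.List.foldr ℤ._+_ (+ 0) (map (λ k → a k ℤ.* a k) elements) ℤ.+ (a∞ ℤ.* a∞)

  #Maff : ℕ
  #Maff = countEq (Data.List.cartesianProduct pairs pairs)
    (λ t → let x₁ = proj₁ (proj₁ t); x₂ = proj₂ (proj₁ t)
               k  = proj₁ (proj₂ t); y  = proj₂ (proj₂ t)
           in ((eval P x₁ * k) + eval Q x₁) * ((eval P x₂ * k) + eval Q x₂))
    (λ t → proj₂ (proj₂ t) * proj₂ (proj₂ t))

  #M∞ : ℕ
  #M∞ = countEq (Data.List.cartesianProduct pairs elements)
    (λ t → eval P (proj₁ (proj₁ t)) * eval P (proj₂ (proj₁ t)))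
    (λ t → proj₂ t * proj₂ t)

  #M : ℕ
  #M = #Maff Data.Nat.+ #M∞

{-# OPTIONS --safe #-}
-- With χ(c) = #{y : y² = c} − 1, the curve y² = f(x) has q + Σ_x χ(f(x)) affine points, so
-- a_{k,q} = −Σ_x χ(f_k(x)) for f_k = Pk + Q, and a_{∞,q} = −Σ_x χ(P(x)). As χ is multiplicative,
-- the fibre of M over (x₁, x₂, k) has 1 + χ(f_k(x₁))χ(f_k(x₂)) points, and summing over x₁, x₂
-- factors the correction term into (Σ_x χ(f_k(x)))² = a_{k,q}²; likewise for M_∞, and the
-- constants add up to q³ + q².
-- Multiplicativity is the one arithmetic input: χ vanishes in characteristic 2, and in odd
-- characteristic the only nontrivial case, nonsquare × nonsquare, follows from
-- Σ_x χ(cx) = Σ_x χ(x) = 0.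
module Submission where

open import Defs
open import Data.Nat as ℕ using (_^_)
open import Data.Integer as ℤ using (ℤ; +_; _+_; _*_; -_; _-_; _≤_; 0ℤ; 1ℤ; -1ℤ)
import Data.Integer.Properties as ℤ
open import Data.Integer.Solver using (module +-*-Solver)
open import Data.List using (List; []; _∷_; _++_; map; foldr; concatMap; cartesianProduct; length)
open import Data.List.Membership.Propositional using (_∈_; lose)
open import Data.List.Relation.Unary.Any using (here; there; any?; satisfied)
open import Data.List.Relation.Unary.All as All using (All)
open import Data.List.Relation.Unary.AllPairs using (_∷_)
open import Data.List.Relation.Unary.Unique.Propositional using (Unique)
open import Data.Product using (_,_; _×_; proj₁; proj₂)
open import Data.Sum using (_⊎_; inj₁; inj₂)
open import Data.Empty using (⊥; ⊥-elim)
open import Function using (_∘_)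
open import Relation.Nullary using (¬_; Dec; yes; no)
open import Relation.Binary.Definitions using (DecidableEquality)
open import Relation.Binary.PropositionalEquality
open import Algebra.Bundles using (CommutativeRing)
import Algebra.Solver.CommutativeMonoid
open import Algebra.Properties.CommutativeSemigroup ℤ.+-commutativeSemigroup
  using () renaming (interchange to +-interchange)

-- Finite sums

-- Written as foldr over map so that the sum in M̃₂ is literally a ∑.
∑ : {A : Set} → List A → (A → ℤ) → ℤ
∑ xs f = foldr _+_ 0ℤ (map f xs)

syntax ∑ xs (λ x → e) = ∑[ x ∈ xs ] e

nonpos+nonpos≡0⇒≡0ˡ : ∀ {i j} → i ≤ 0ℤ → j ≤ 0ℤ → i + j ≡ 0ℤ → i ≡ 0ℤ
nonpos+nonpos≡0⇒≡0ˡ {i} {j} i≤0 j≤0 i+j≡0 = ℤ.≤-antisym i≤0 (begin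
  0ℤ     ≡⟨ i+j≡0 ⟨
  i + j  ≤⟨ ℤ.+-monoʳ-≤ i j≤0 ⟩
  i + 0ℤ ≡⟨ ℤ.+-identityʳ i ⟩
  i      ∎)
  where open ℤ.≤-Reasoning

module _ {A : Set} where

  ∑-cong : (xs : List A) {f g : A → ℤ} → (∀ x → f x ≡ g x) → ∑ xs f ≡ ∑ xs g
  ∑-cong []       f≗g = refl
  ∑-cong (x ∷ xs) f≗g = cong₂ _+_ (f≗g x) (∑-cong xs f≗g)

  ∑-++ : (xs ys : List A) (f : A → ℤ) → ∑ (xs ++ ys) f ≡ ∑ xs f + ∑ ys f
  ∑-++ []       ys f = sym (ℤ.+-identityˡ _)
  ∑-++ (x ∷ xs) ys f = trans (cong (_+_ (f x)) (∑-++ xs ys f)) (sym (ℤ.+-assoc (f x) _ _))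

  ∑-+ : (xs : List A) (f g : A → ℤ) → ∑[ x ∈ xs ] (f x + g x) ≡ ∑ xs f + ∑ xs g
  ∑-+ []       f g = refl
  ∑-+ (x ∷ xs) f g = trans (cong (_+_ (f x + g x)) (∑-+ xs f g)) (+-interchange (f x) (g x) _ _)

  ∑-*ˡ : (xs : List A) (c : ℤ) (f : A → ℤ) → ∑[ x ∈ xs ] (c * f x) ≡ c * ∑ xs f
  ∑-*ˡ []       c f = sym (ℤ.*-zeroʳ c)
  ∑-*ˡ (x ∷ xs) c f =
    trans (cong (_+_ (c * f x)) (∑-*ˡ xs c f)) (sym (ℤ.*-distribˡ-+ c (f x) _))

  ∑-*ʳ : (xs : List A) (c : ℤ) (f : A → ℤ) → ∑[ x ∈ xs ] (f x * c) ≡ ∑ xs f * c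
  ∑-*ʳ []       c f = sym (ℤ.*-zeroˡ c)
  ∑-*ʳ (x ∷ xs) c f =
    trans (cong (_+_ (f x * c)) (∑-*ʳ xs c f)) (sym (ℤ.*-distribʳ-+ c (f x) _))

  ∑-const : (xs : List A) (c : ℤ) → ∑[ x ∈ xs ] c ≡ + length xs * c
  ∑-const []       c = sym (ℤ.*-zeroˡ c)
  ∑-const (x ∷ xs) c = begin
    c + ∑[ x ∈ xs ] c        ≡⟨ cong₂ _+_ (sym (ℤ.*-identityˡ c)) (∑-const xs c) ⟩
    1ℤ * c + + length xs * c ≡⟨ ℤ.*-distribʳ-+ c 1ℤ (+ length xs) ⟨
    + length (x ∷ xs) * c    ∎
    where open ≡-Reasoning

  ∑-All-zero : (xs : List A) {f : A → ℤ} → All (λ x → f x ≡ 0ℤ) xs → ∑ xs f ≡ 0ℤ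
  ∑-All-zero []       All.[]           = refl
  ∑-All-zero (x ∷ xs) (fx≡0 All.∷ f≡0) = cong₂ _+_ fx≡0 (∑-All-zero xs f≡0)

  ∑-nonpos : (xs : List A) {f : A → ℤ} → (∀ x → f x ≤ 0ℤ) → ∑ xs f ≤ 0ℤ
  ∑-nonpos []       f≤0 = ℤ.≤-refl
  ∑-nonpos (x ∷ xs) f≤0 = ℤ.+-mono-≤ (f≤0 x) (∑-nonpos xs f≤0)

  ∑-nonpos≡0⇒≡0 : (xs : List A) {f : A → ℤ} → (∀ x → f x ≤ 0ℤ) → ∑ xs f ≡ 0ℤ →
                   ∀ {x} → x ∈ xs → f x ≡ 0ℤ
  ∑-nonpos≡0⇒≡0 (y ∷ ys) f≤0 sum≡0 (here refl) =
    nonpos+nonpos≡0⇒≡0ˡ (f≤0 y) (∑-nonpos ys f≤0) sum≡0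
  ∑-nonpos≡0⇒≡0 (y ∷ ys) {f} f≤0 sum≡0 (there x∈ys) =
    ∑-nonpos≡0⇒≡0 ys f≤0 (nonpos+nonpos≡0⇒≡0ˡ (∑-nonpos ys f≤0) (f≤0 y)
                            (trans (ℤ.+-comm (∑ ys f) (f y)) sum≡0)) x∈ys

  ∑-1+product : (xs : List A) (f : A → ℤ) →
                ∑[ x₁ ∈ xs ] ∑[ x₂ ∈ xs ] (1ℤ + f x₁ * f x₂)
                  ≡ + length xs * + length xs + ∑ xs f * ∑ xs f
  ∑-1+product xs f = begin
    ∑[ x₁ ∈ xs ] ∑[ x₂ ∈ xs ] (1ℤ + f x₁ * f x₂)
      ≡⟨ ∑-cong xs row ⟩
    ∑[ x₁ ∈ xs ] (n + f x₁ * ∑ xs f)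
      ≡⟨ ∑-+ xs (λ _ → n) _ ⟩
    ∑[ x₁ ∈ xs ] n + ∑[ x₁ ∈ xs ] (f x₁ * ∑ xs f)
      ≡⟨ cong₂ _+_ (∑-const xs n) (∑-*ʳ xs (∑ xs f) f) ⟩
    n * n + ∑ xs f * ∑ xs f
      ∎
    where
    open ≡-Reasoning
    n : ℤ
    n = + length xs
    row : ∀ x₁ → ∑[ x₂ ∈ xs ] (1ℤ + f x₁ * f x₂) ≡ n + f x₁ * ∑ xs f
    row x₁ = trans (∑-+ xs (λ _ → 1ℤ) _)
                   (cong₂ _+_ (trans (∑-const xs 1ℤ) (ℤ.*-identityʳ n)) (∑-*ˡ xs (f x₁) f))

∑-map : {A B : Set} (h : A → B) (xs : List A) (f : B → ℤ) →
        ∑ (map h xs) f ≡ ∑ xs (f ∘ h)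
∑-map h []       f = refl
∑-map h (x ∷ xs) f = cong (_+_ (f (h x))) (∑-map h xs f)

module _ {A B : Set} where

  ∑-concatMap : (h : A → List B) (xs : List A) (f : B → ℤ) →
                ∑ (concatMap h xs) f ≡ ∑[ x ∈ xs ] ∑ (h x) f
  ∑-concatMap h []       f = refl
  ∑-concatMap h (x ∷ xs) f =
    trans (∑-++ (h x) (concatMap h xs) f) (cong (_+_ (∑ (h x) f)) (∑-concatMap h xs f))

  ∑-cartesianProduct : (xs : List A) (ys : List B) (f : A × B → ℤ) →
                       ∑ (cartesianProduct xs ys) f ≡ ∑[ x ∈ xs ] ∑[ y ∈ ys ] f (x , y)
  ∑-cartesianProduct []       ys f = refl
  ∑-cartesianProduct (x ∷ xs) ys f =
    trans (∑-++ (map (x ,_) ys) _ f) (cong₂ _+_ (∑-map (x ,_) ys f) (∑-cartesianProduct xs ys f))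

  ∑-swap : (xs : List A) (ys : List B) (f : A → B → ℤ) →
           ∑[ x ∈ xs ] ∑[ y ∈ ys ] f x y ≡ ∑[ y ∈ ys ] ∑[ x ∈ xs ] f x y
  ∑-swap []       ys f = sym (trans (∑-const ys 0ℤ) (ℤ.*-zeroʳ (+ length ys)))
  ∑-swap (x ∷ xs) ys f = trans (cong (_+_ (∑ ys (f x))) (∑-swap xs ys f))
                               (sym (∑-+ ys (f x) (λ y → ∑[ x ∈ xs ] f x y)))

𝟙 : {P : Set} → Dec P → ℤ
𝟙 (yes _) = 1ℤ
𝟙 (no _)  = 0ℤ

𝟙-yes : {P : Set} (p? : Dec P) → P → 𝟙 p? ≡ 1ℤ
𝟙-yes (yes _) p = refl
𝟙-yes (no ¬p) p = ⊥-elim (¬p p)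

𝟙-no : {P : Set} (p? : Dec P) → ¬ P → 𝟙 p? ≡ 0ℤ
𝟙-no (yes p) ¬p = ⊥-elim (¬p p)
𝟙-no (no _)  ¬p = refl

𝟙-⇔ : {P Q : Set} (p? : Dec P) (q? : Dec Q) → (P → Q) → (Q → P) → 𝟙 p? ≡ 𝟙 q?
𝟙-⇔ (yes _) (yes _) P→Q Q→P = refl
𝟙-⇔ (yes p) (no ¬q) P→Q Q→P = ⊥-elim (¬q (P→Q p))
𝟙-⇔ (no ¬p) (yes q) P→Q Q→P = ⊥-elim (¬p (Q→P q))
𝟙-⇔ (no _)  (no _)  P→Q Q→P = refl

∑-𝟙≟-unique : {A : Set} (_≟_ : DecidableEquality A) {xs : List A} → Unique xs →
              ∀ {u} → u ∈ xs → ∑[ x ∈ xs ] 𝟙 (x ≟ u) ≡ 1ℤ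
∑-𝟙≟-unique _≟_ {u ∷ xs} (u∉xs ∷ _) (here refl) =
  cong₂ _+_ (𝟙-yes (u ≟ u) refl)
            (∑-All-zero xs (All.map (λ u≢x → 𝟙-no (_ ≟ u) (u≢x ∘ sym)) u∉xs))
∑-𝟙≟-unique _≟_ (y∉ys ∷ ys-unique) {u} (there u∈ys) =
  cong₂ _+_ (𝟙-no (_ ≟ u) (All.lookup y∉ys u∈ys)) (∑-𝟙≟-unique _≟_ ys-unique u∈ys)

-- Arithmetic in a finite field

module QuadraticCharacter (F : FiniteField) where

  open FiniteField F
    renaming (_+_ to infixl 6 _+F_; _*_ to infixl 7 _·_; -_ to infix 8 -F_; _≟_ to infix 4 _≟_)

  commutativeRing : CommutativeRing _ _
  commutativeRing = record { isCommutativeRing = isCommutativeRing }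

  open CommutativeRing commutativeRing
    using (*-identityˡ; zeroˡ; zeroʳ; *-comm; +-comm; distribˡ; distribʳ; -‿inverseʳ; +-group; ring)
  open import Algebra.Properties.Ring ring
    using ([y-z]x≈yx-zx; -‿involutive; -‿distribˡ-*; -‿distribʳ-*)
  open import Algebra.Properties.Group +-group using (x∙y⁻¹≈ε⇒x≈y; inverseˡ-unique)
  module CM = Algebra.Solver.CommutativeMonoid (CommutativeRing.*-commutativeMonoid commutativeRing)
  open CM using (_⊜_; _⊕_)

  inverse-cancelˡ : ∀ {c c⁻¹} → c · c⁻¹ ≡ 1# → ∀ x → c⁻¹ · (c · x) ≡ x
  inverse-cancelˡ {c} {c⁻¹} cc⁻¹≡1 x = begin
    c⁻¹ · (c · x) ≡⟨ CM.solve 3 (λ a b x → b ⊕ (a ⊕ x) ⊜ (a ⊕ b) ⊕ x) refl _ _ _ ⟩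
    (c · c⁻¹) · x ≡⟨ cong (_· x) cc⁻¹≡1 ⟩
    1# · x        ≡⟨ *-identityˡ x ⟩
    x             ∎
    where open ≡-Reasoning

  inverse-cancelʳ : ∀ {c c⁻¹} → c · c⁻¹ ≡ 1# → ∀ x → c · (c⁻¹ · x) ≡ x
  inverse-cancelʳ {c} {c⁻¹} cc⁻¹≡1 x =
    trans (CM.solve 3 (λ a b x → a ⊕ (b ⊕ x) ⊜ b ⊕ (a ⊕ x)) refl c c⁻¹ x)
          (inverse-cancelˡ cc⁻¹≡1 x)

  ·-cancelˡ : ∀ {c} → ¬ c ≡ 0# → ∀ {x y} → c · x ≡ c · y → x ≡ y
  ·-cancelˡ {c} c≢0 {x} {y} cx≡cy with inverse c c≢0
  ... | c⁻¹ , cc⁻¹≡1 = begin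
    x             ≡⟨ inverse-cancelˡ cc⁻¹≡1 x ⟨
    c⁻¹ · (c · x) ≡⟨ cong (c⁻¹ ·_) cx≡cy ⟩
    c⁻¹ · (c · y) ≡⟨ inverse-cancelˡ cc⁻¹≡1 y ⟩
    y             ∎
    where open ≡-Reasoning

  ·-zero⇒zero : ∀ {x y} → x · y ≡ 0# → ¬ x ≡ 0# → y ≡ 0#
  ·-zero⇒zero {x} xy≡0 x≢0 = ·-cancelˡ x≢0 (trans xy≡0 (sym (zeroʳ x)))

  ·-nonzero : ∀ {x y} → ¬ x ≡ 0# → ¬ y ≡ 0# → ¬ x · y ≡ 0#
  ·-nonzero x≢0 y≢0 xy≡0 = y≢0 (·-zero⇒zero xy≡0 x≢0)

  square≡0⇒≡0 : ∀ {y} → y · y ≡ 0# → y ≡ 0#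
  square≡0⇒≡0 {y} yy≡0 with y ≟ 0#
  ... | yes y≡0 = y≡0
  ... | no  y≢0 = ·-zero⇒zero yy≡0 y≢0

  square-roots : ∀ {y u} → y · y ≡ u · u → y ≡ u ⊎ y ≡ -F u
  square-roots {y} {u} yy≡uu with y +F -F u ≟ 0#
  ... | yes y-u≡0 = inj₁ (x∙y⁻¹≈ε⇒x≈y y u y-u≡0)
  ... | no  y-u≢0 = inj₂ (inverseˡ-unique y u (·-zero⇒zero difference-of-squares y-u≢0))
    where
    difference-of-squares : (y +F -F u) · (y +F u) ≡ 0#
    difference-of-squares = begin
      (y +F -F u) · (y +F u)
        ≡⟨ [y-z]x≈yx-zx (y +F u) y u ⟩
      y · (y +F u) +F -F (u · (y +F u))
        ≡⟨ cong₂ (λ s t → s +F -F t) (distribˡ y y u) (distribˡ u y u) ⟩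
      (y · y +F y · u) +F -F (u · y +F u · u)
        ≡⟨ cong₂ (λ s t → (s +F t) +F -F (u · y +F u · u)) yy≡uu (*-comm y u) ⟩
      (u · u +F u · y) +F -F (u · y +F u · u)
        ≡⟨ cong (λ s → s +F -F (u · y +F u · u)) (+-comm (u · u) (u · y)) ⟩
      (u · y +F u · u) +F -F (u · y +F u · u)
        ≡⟨ -‿inverseʳ _ ⟩
      0#
        ∎
      where open ≡-Reasoning

  -‿square : ∀ u → (-F u) · (-F u) ≡ u · u
  -‿square u = begin
    (-F u) · (-F u) ≡⟨ -‿distribˡ-* u (-F u) ⟨
    -F (u · -F u)   ≡⟨ cong -F_ (-‿distribʳ-* u u) ⟨
    -F (-F (u · u)) ≡⟨ -‿involutive (u · u) ⟩
    u · u           ∎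
    where open ≡-Reasoning

  [1+1]·u≡u+u : ∀ u → (1# +F 1#) · u ≡ u +F u
  [1+1]·u≡u+u u = trans (distribʳ u 1# 1#) (cong₂ _+F_ (*-identityˡ u) (*-identityˡ u))

  -‿char2 : 1# +F 1# ≡ 0# → ∀ u → -F u ≡ u
  -‿char2 1+1≡0 u = sym (inverseˡ-unique u u (begin
    u +F u         ≡⟨ [1+1]·u≡u+u u ⟨
    (1# +F 1#) · u ≡⟨ cong (_· u) 1+1≡0 ⟩
    0# · u         ≡⟨ zeroˡ u ⟩
    0#             ∎))
    where open ≡-Reasoning

  ≢-‿odd : ¬ 1# +F 1# ≡ 0# → ∀ {u} → ¬ u ≡ 0# → ¬ u ≡ -F u
  ≢-‿odd 1+1≢0 {u} u≢0 u≡-u = u≢0 (·-zero⇒zero (begin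
    (1# +F 1#) · u ≡⟨ [1+1]·u≡u+u u ⟩
    u +F u         ≡⟨ cong (u +F_) u≡-u ⟩
    u +F -F u      ≡⟨ -‿inverseʳ u ⟩
    0#             ∎) 1+1≢0)
    where open ≡-Reasoning

  𝟙-sym : ∀ x y → 𝟙 (x ≟ y) ≡ 𝟙 (y ≟ x)
  𝟙-sym x y = 𝟙-⇔ (x ≟ y) (y ≟ x) sym sym

  ∑-𝟙≟ : ∀ u → ∑[ x ∈ elements ] 𝟙 (x ≟ u) ≡ 1ℤ
  ∑-𝟙≟ u = ∑-𝟙≟-unique _≟_ unique (complete u)

  ∑-𝟙≟-* : ∀ u c → ∑[ x ∈ elements ] (𝟙 (x ≟ u) * c) ≡ c
  ∑-𝟙≟-* u c = begin
    ∑[ x ∈ elements ] (𝟙 (x ≟ u) * c) ≡⟨ ∑-*ʳ elements c _ ⟩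
    ∑[ x ∈ elements ] 𝟙 (x ≟ u) * c   ≡⟨ cong (_* c) (∑-𝟙≟ u) ⟩
    1ℤ * c                             ≡⟨ ℤ.*-identityˡ c ⟩
    c                                  ∎
    where open ≡-Reasoning

  ∑-δ : ∀ u (f : Carrier → ℤ) → ∑[ x ∈ elements ] (𝟙 (x ≟ u) * f x) ≡ f u
  ∑-δ u f = trans (∑-cong elements δ-at) (∑-𝟙≟-* u (f u))
    where
    δ-at : ∀ x → 𝟙 (x ≟ u) * f x ≡ 𝟙 (x ≟ u) * f u
    δ-at x with x ≟ u
    ... | yes refl = refl
    ... | no  _    = trans (ℤ.*-zeroˡ (f x)) (sym (ℤ.*-zeroˡ (f u)))

  ∑-reindex : (h g : Carrier → Carrier) → (∀ x → g (h x) ≡ x) → (∀ y → h (g y) ≡ y) →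
              (f : Carrier → ℤ) → ∑[ x ∈ elements ] f (h x) ≡ ∑ elements f
  ∑-reindex h g gh≗id hg≗id f = begin
    ∑[ x ∈ elements ] f (h x)
      ≡⟨ ∑-cong elements (λ x → sym (∑-δ (h x) f)) ⟩
    ∑[ x ∈ elements ] ∑[ y ∈ elements ] (𝟙 (y ≟ h x) * f y)
      ≡⟨ ∑-swap elements elements _ ⟩
    ∑[ y ∈ elements ] ∑[ x ∈ elements ] (𝟙 (y ≟ h x) * f y)
      ≡⟨ ∑-cong elements fibre ⟩
    ∑ elements f
      ∎
    where
    open ≡-Reasoning
    fibre : ∀ y → ∑[ x ∈ elements ] (𝟙 (y ≟ h x) * f y) ≡ f y
    fibre y = trans (∑-cong elements (λ x → cong (_* f y) (𝟙-⇔ (y ≟ h x) (x ≟ g y)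
                      (λ { refl → sym (gh≗id x) }) (λ { refl → sym (hg≗id y) }))))
                    (∑-𝟙≟-* (g y) (f y))

  -- The quadratic character

  roots : Carrier → ℤ
  roots c = ∑[ y ∈ elements ] 𝟙 (y · y ≟ c)

  χ : Carrier → ℤ
  χ c = roots c - 1ℤ

  roots≡1+χ : ∀ c → roots c ≡ 1ℤ + χ c
  roots≡1+χ c = solve 1 (λ r → r := con 1ℤ :+ (r :- con 1ℤ)) refl (roots c)
    where open +-*-Solver

  ∑-roots : ∑ elements roots ≡ + order
  ∑-roots = begin
    ∑[ c ∈ elements ] ∑[ y ∈ elements ] 𝟙 (y · y ≟ c) ≡⟨ ∑-swap elements elements _ ⟩
    ∑[ y ∈ elements ] ∑[ c ∈ elements ] 𝟙 (y · y ≟ c) ≡⟨ ∑-cong elements one-square ⟩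
    ∑[ y ∈ elements ] 1ℤ                              ≡⟨ ∑-const elements 1ℤ ⟩
    + order * 1ℤ                                      ≡⟨ ℤ.*-identityʳ (+ order) ⟩
    + order                                           ∎
    where
    open ≡-Reasoning
    one-square : ∀ y → ∑[ c ∈ elements ] 𝟙 (y · y ≟ c) ≡ 1ℤ
    one-square y = trans (∑-cong elements (𝟙-sym (y · y))) (∑-𝟙≟ (y · y))

  ∑-χ : ∑ elements χ ≡ 0ℤ
  ∑-χ = begin
    ∑ elements χ
      ≡⟨ ∑-+ elements roots (λ _ → -1ℤ) ⟩
    ∑ elements roots + ∑[ c ∈ elements ] -1ℤ
      ≡⟨ cong₂ _+_ ∑-roots (∑-const elements -1ℤ) ⟩
    + order + + order * -1ℤ
      ≡⟨ solve 1 (λ n → n :+ n :* con -1ℤ := con 0ℤ) refl (+ order) ⟩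
    0ℤ
      ∎
    where
    open ≡-Reasoning
    open +-*-Solver

  ∑-χ-scaled : ∀ {c} → ¬ c ≡ 0# → ∑[ x ∈ elements ] χ (c · x) ≡ 0ℤ
  ∑-χ-scaled {c} c≢0 with inverse c c≢0
  ... | c⁻¹ , cc⁻¹≡1 =
    trans (∑-reindex (c ·_) (c⁻¹ ·_) (inverse-cancelˡ cc⁻¹≡1) (inverse-cancelʳ cc⁻¹≡1) χ)
          ∑-χ

  χ-0 : χ 0# ≡ 0ℤ
  χ-0 = cong (_- 1ℤ) (trans (∑-cong elements only-0) (∑-𝟙≟ 0#))
    where
    only-0 : ∀ y → 𝟙 (y · y ≟ 0#) ≡ 𝟙 (y ≟ 0#)
    only-0 y = 𝟙-⇔ (y · y ≟ 0#) (y ≟ 0#) square≡0⇒≡0 (λ { refl → zeroˡ 0# })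

  χ-nonsquare : ∀ {c} → (∀ y → ¬ y · y ≡ c) → χ c ≡ -1ℤ
  χ-nonsquare {c} nonsquare-c =
    cong (_- 1ℤ) (∑-All-zero elements
      (All.tabulate (λ {y} _ → 𝟙-no (y · y ≟ c) (nonsquare-c y))))

  χ-scale : ∀ {u} → ¬ u ≡ 0# → ∀ d → χ ((u · u) · d) ≡ χ d
  χ-scale {u} u≢0 d with inverse u u≢0
  ... | u⁻¹ , uu⁻¹≡1 = cong (_- 1ℤ) (begin
    ∑[ y ∈ elements ] 𝟙 (y · y ≟ (u · u) · d)
      ≡⟨ ∑-reindex (u ·_) (u⁻¹ ·_) (inverse-cancelˡ uu⁻¹≡1) (inverse-cancelʳ uu⁻¹≡1) _ ⟨
    ∑[ z ∈ elements ] 𝟙 ((u · z) · (u · z) ≟ (u · u) · d)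
      ≡⟨ ∑-cong elements cancel-u² ⟩
    ∑[ z ∈ elements ] 𝟙 (z · z ≟ d)
      ∎)
    where
    open ≡-Reasoning
    regroup : ∀ z → (u · z) · (u · z) ≡ (u · u) · (z · z)
    regroup = CM.solve 2 (λ u z → (u ⊕ z) ⊕ (u ⊕ z) ⊜ (u ⊕ u) ⊕ (z ⊕ z)) refl u
    cancel-u² : ∀ z → 𝟙 ((u · z) · (u · z) ≟ (u · u) · d) ≡ 𝟙 (z · z ≟ d)
    cancel-u² z = 𝟙-⇔ _ _ (λ e → ·-cancelˡ (·-nonzero u≢0 u≢0) (trans (sym (regroup z)) e))
                          (λ { refl → regroup z })

  data SquareClass (c : Carrier) : Set where
    zero      : c ≡ 0# → SquareClass c
    square    : ∀ u → ¬ u ≡ 0# → c ≡ u · u → SquareClass c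
    nonsquare : (∀ y → ¬ y · y ≡ c) → SquareClass c

  squareClass : ∀ c → SquareClass c
  squareClass c with c ≟ 0#
  ... | yes c≡0 = zero c≡0
  ... | no  c≢0 with any? (λ y → y · y ≟ c) elements
  ...   | no  no-root  = nonsquare (λ y yy≡c → no-root (lose (complete y) yy≡c))
  ...   | yes has-root with satisfied has-root
  ...     | u , uu≡c = square u (λ { refl → c≢0 (trans (sym uu≡c) (zeroˡ 0#)) }) (sym uu≡c)

  -- Squaring is injective, so χ ≤ 0 everywhere, and Σ χ = 0 forces χ = 0.
  χ-char2 : 1# +F 1# ≡ 0# → ∀ c → χ c ≡ 0ℤ
  χ-char2 1+1≡0 c = ∑-nonpos≡0⇒≡0 elements χ≤0 ∑-χ (complete c)
    where
    root-unique : ∀ {y u} → y · y ≡ u · u → y ≡ u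
    root-unique yy≡uu with square-roots yy≡uu
    ... | inj₁ y≡u  = y≡u
    ... | inj₂ y≡-u = trans y≡-u (-‿char2 1+1≡0 _)
    χ≤0 : ∀ c → χ c ≤ 0ℤ
    χ≤0 c with squareClass c
    ... | zero refl = ℤ.≤-reflexive χ-0
    ... | square u _ refl =
            ℤ.≤-reflexive (cong (_- 1ℤ) (trans (∑-cong elements one-root) (∑-𝟙≟ u)))
      where
      one-root : ∀ y → 𝟙 (y · y ≟ u · u) ≡ 𝟙 (y ≟ u)
      one-root y = 𝟙-⇔ (y · y ≟ u · u) (y ≟ u) root-unique (λ { refl → refl })
    ... | nonsquare nonsquare-c = ℤ.≤-trans (ℤ.≤-reflexive (χ-nonsquare nonsquare-c)) ℤ.-≤+

  module OddCharacteristic (1+1≢0 : ¬ 1# +F 1# ≡ 0#) where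

    χ-square : ∀ {u} → ¬ u ≡ 0# → χ (u · u) ≡ 1ℤ
    χ-square {u} u≢0 = cong (_- 1ℤ) (begin
      ∑[ y ∈ elements ] 𝟙 (y · y ≟ u · u)
        ≡⟨ ∑-cong elements two-roots ⟩
      ∑[ y ∈ elements ] (𝟙 (y ≟ u) + 𝟙 (y ≟ -F u))
        ≡⟨ ∑-+ elements _ _ ⟩
      ∑[ y ∈ elements ] 𝟙 (y ≟ u) + ∑[ y ∈ elements ] 𝟙 (y ≟ -F u)
        ≡⟨ cong₂ _+_ (∑-𝟙≟ u) (∑-𝟙≟ (-F u)) ⟩
      + 2
        ∎)
      where
      open ≡-Reasoning
      two-roots : ∀ y → 𝟙 (y · y ≟ u · u) ≡ 𝟙 (y ≟ u) + 𝟙 (y ≟ -F u)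
      two-roots y with y ≟ u | y ≟ -F u
      ... | yes refl | yes y≡-y = ⊥-elim (≢-‿odd 1+1≢0 u≢0 y≡-y)
      ... | yes refl | no  _    = 𝟙-yes (y · y ≟ y · y) refl
      ... | no  _    | yes refl = 𝟙-yes (-F u · -F u ≟ u · u) (-‿square u)
      ... | no  y≢u  | no  y≢-u = 𝟙-no (y · y ≟ u · u) (neither ∘ square-roots)
        where
        neither : y ≡ u ⊎ y ≡ -F u → ⊥
        neither (inj₁ y≡u)  = y≢u y≡u
        neither (inj₂ y≡-u) = y≢-u y≡-u

    χ≤1 : ∀ c → χ c ≤ 1ℤ
    χ≤1 c with squareClass c
    ... | zero refl             = ℤ.≤-trans (ℤ.≤-reflexive χ-0) (ℤ.+≤+ ℕ.z≤n)
    ... | square u u≢0 refl     = ℤ.≤-reflexive (χ-square u≢0)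
    ... | nonsquare nonsquare-c = ℤ.≤-trans (ℤ.≤-reflexive (χ-nonsquare nonsquare-c)) ℤ.-≤+

    -- Σ_x (χ(cx) + χ(x)) = 0, and for nonsquare c every term is ≤ 0 (it is 0 at squares
    -- x = u², where χ(cu²) = χ(c)); so every term vanishes, in particular the one at x = d.
    χ-nonsquare·nonsquare : ∀ {c d} → (∀ y → ¬ y · y ≡ c) → (∀ y → ¬ y · y ≡ d) →
                            χ (c · d) ≡ 1ℤ
    χ-nonsquare·nonsquare {c} {d} nonsquare-c nonsquare-d = begin
      χ (c · d)               ≡⟨ solve 2 (λ i j → i := (i :+ j) :- j) refl (χ (c · d)) (χ d) ⟩
      (χ (c · d) + χ d) - χ d ≡⟨ cong₂ _-_ g-d≡0 (χ-nonsquare nonsquare-d) ⟩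
      0ℤ - -1ℤ                ∎
      where
      open ≡-Reasoning
      open +-*-Solver using (solve; _:=_; _:+_; _:-_)
      c≢0 : ¬ c ≡ 0#
      c≢0 c≡0 = nonsquare-c 0# (trans (zeroˡ 0#) (sym c≡0))
      g : Carrier → ℤ
      g x = χ (c · x) + χ x
      g≤0 : ∀ x → g x ≤ 0ℤ
      g≤0 x with squareClass x
      ... | zero refl = ℤ.≤-reflexive (cong₂ _+_ (trans (cong χ (zeroʳ c)) χ-0) χ-0)
      ... | square u u≢0 refl = ℤ.≤-reflexive (cong₂ _+_
              (trans (cong χ (*-comm c (u · u))) (trans (χ-scale u≢0 c) (χ-nonsquare nonsquare-c)))
              (χ-square u≢0))
      ... | nonsquare nonsquare-x =
              ℤ.+-mono-≤ (χ≤1 (c · x)) (ℤ.≤-reflexive (χ-nonsquare nonsquare-x))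
      g-d≡0 : g d ≡ 0ℤ
      g-d≡0 = ∑-nonpos≡0⇒≡0 elements g≤0
                (trans (∑-+ elements (λ x → χ (c · x)) χ) (cong₂ _+_ (∑-χ-scaled c≢0) ∑-χ))
                (complete d)

    χ-multiplicative : ∀ c d → χ (c · d) ≡ χ c * χ d
    χ-multiplicative c d with squareClass c | squareClass d
    ... | zero refl | _ = begin
      χ (0# · d) ≡⟨ cong χ (zeroˡ d) ⟩
      χ 0#       ≡⟨ χ-0 ⟩
      0ℤ         ≡⟨ ℤ.*-zeroˡ (χ d) ⟨
      0ℤ * χ d   ≡⟨ cong (_* χ d) χ-0 ⟨
      χ 0# * χ d ∎
      where open ≡-Reasoning
    ... | _ | zero refl = begin
      χ (c · 0#) ≡⟨ cong χ (zeroʳ c) ⟩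
      χ 0#       ≡⟨ χ-0 ⟩
      0ℤ         ≡⟨ ℤ.*-zeroʳ (χ c) ⟨
      χ c * 0ℤ   ≡⟨ cong (χ c *_) χ-0 ⟨
      χ c * χ 0# ∎
      where open ≡-Reasoning
    ... | square u u≢0 refl | _ = begin
      χ ((u · u) · d) ≡⟨ χ-scale u≢0 d ⟩
      χ d             ≡⟨ ℤ.*-identityˡ (χ d) ⟨
      1ℤ * χ d        ≡⟨ cong (_* χ d) (χ-square u≢0) ⟨
      χ (u · u) * χ d ∎
      where open ≡-Reasoning
    ... | _ | square v v≢0 refl = begin
      χ (c · (v · v)) ≡⟨ cong χ (*-comm c (v · v)) ⟩
      χ ((v · v) · c) ≡⟨ χ-scale v≢0 c ⟩
      χ c             ≡⟨ ℤ.*-identityʳ (χ c) ⟨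
      χ c * 1ℤ        ≡⟨ cong (χ c *_) (χ-square v≢0) ⟨
      χ c * χ (v · v) ∎
      where open ≡-Reasoning
    ... | nonsquare nonsquare-c | nonsquare nonsquare-d = begin
      χ (c · d) ≡⟨ χ-nonsquare·nonsquare nonsquare-c nonsquare-d ⟩
      -1ℤ * -1ℤ ≡⟨ cong₂ _*_ (χ-nonsquare nonsquare-c) (χ-nonsquare nonsquare-d) ⟨
      χ c * χ d ∎
      where open ≡-Reasoning

  χ-multiplicative : ∀ c d → χ (c · d) ≡ χ c * χ d
  χ-multiplicative c d with 1# +F 1# ≟ 0#
  ... | yes 1+1≡0 =
    trans (χ-char2 1+1≡0 (c · d)) (sym (cong₂ _*_ (χ-char2 1+1≡0 c) (χ-char2 1+1≡0 d)))
  ... | no  1+1≢0 = OddCharacteristic.χ-multiplicative 1+1≢0 c d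

-- Point counts

module PointCounts (F : FiniteField) where

  open FiniteField F using (Carrier; elements; order; pairs; countEq)
    renaming (_*_ to infixl 7 _·_; _≟_ to infix 4 _≟_)
  open QuadraticCharacter F using (𝟙-sym; roots; roots≡1+χ; χ; χ-multiplicative)

  count-as-∑ : {A : Set} (xs : List A) (f g : A → Carrier) →
               + countEq xs f g ≡ ∑[ x ∈ xs ] 𝟙 (f x ≟ g x)
  count-as-∑ []       f g = refl
  count-as-∑ (x ∷ xs) f g with f x ≟ g x
  ... | yes _ = cong (_+_ 1ℤ) (count-as-∑ xs f g)
  ... | no  _ = trans (count-as-∑ xs f g) (sym (ℤ.+-identityˡ _))

  ∑-pairs : (f : Carrier × Carrier → ℤ) →
            ∑ pairs f ≡ ∑[ x ∈ elements ] ∑[ y ∈ elements ] f (x , y)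
  ∑-pairs f = trans (∑-concatMap _ elements f) (∑-cong elements (λ x → ∑-map _ elements f))

  #y²≡f : (f : Carrier → Carrier) →
          + countEq pairs (λ xy → proj₂ xy · proj₂ xy) (λ xy → f (proj₁ xy))
            ≡ + order + ∑[ x ∈ elements ] χ (f x)
  #y²≡f f = begin
    + countEq pairs (λ xy → proj₂ xy · proj₂ xy) (λ xy → f (proj₁ xy))
      ≡⟨ trans (count-as-∑ pairs _ _) (∑-pairs _) ⟩
    ∑[ x ∈ elements ] roots (f x)
      ≡⟨ ∑-cong elements (roots≡1+χ ∘ f) ⟩
    ∑[ x ∈ elements ] (1ℤ + χ (f x))
      ≡⟨ ∑-+ elements (λ _ → 1ℤ) (χ ∘ f) ⟩
    ∑[ x ∈ elements ] 1ℤ + ∑[ x ∈ elements ] χ (f x)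
      ≡⟨ cong (_+ ∑[ x ∈ elements ] χ (f x)) (trans (∑-const elements 1ℤ) (ℤ.*-identityʳ n)) ⟩
    n + ∑[ x ∈ elements ] χ (f x)
      ∎
    where
    open ≡-Reasoning
    n : ℤ
    n = + order

  #uv≡y² : ∀ u v → ∑[ y ∈ elements ] 𝟙 (u · v ≟ y · y) ≡ 1ℤ + χ u * χ v
  #uv≡y² u v = begin
    ∑[ y ∈ elements ] 𝟙 (u · v ≟ y · y)
      ≡⟨ ∑-cong elements (λ y → 𝟙-sym (u · v) (y · y)) ⟩
    roots (u · v)
      ≡⟨ roots≡1+χ (u · v) ⟩
    1ℤ + χ (u · v)
      ≡⟨ cong (_+_ 1ℤ) (χ-multiplicative u v) ⟩
    1ℤ + χ u * χ v
      ∎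
    where open ≡-Reasoning

  #g₁g₂≡y² : (g : Carrier → Carrier) →
             ∑[ x₁ ∈ elements ] ∑[ x₂ ∈ elements ] ∑[ y ∈ elements ] 𝟙 (g x₁ · g x₂ ≟ y · y)
               ≡ + order * + order
                 + ∑[ x ∈ elements ] χ (g x) * ∑[ x ∈ elements ] χ (g x)
  #g₁g₂≡y² g =
    trans (∑-cong elements (λ x₁ → ∑-cong elements (λ x₂ → #uv≡y² (g x₁) (g x₂))))
          (∑-1+product elements (χ ∘ g))

module Threefold (F : FiniteField) (P Q : List ℤ) where

  open FiniteField F using (Carrier; elements; order; eval; pairs)
    renaming (_+_ to infixl 6 _+F_; _*_ to infixl 7 _·_; _≟_ to infix 4 _≟_)
  open QuadraticCharacter F using (χ)
  open PointCounts F

  fibre : Carrier → Carrier → Carrier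
  fibre k x = eval P x · k +F eval Q x

  A : Carrier → ℤ
  A k = ∑[ x ∈ elements ] χ (fibre k x)

  B : ℤ
  B = ∑[ x ∈ elements ] χ (eval P x)

  n-[n+t]≡-t : ∀ n t → n - (n + t) ≡ - t
  n-[n+t]≡-t = solve 2 (λ n t → n :- (n :+ t) := :- t) refl
    where open +-*-Solver

  a≡-A : ∀ k → a F P Q k ≡ - A k
  a≡-A k = trans (cong (_-_ (+ order)) (#y²≡f (fibre k))) (n-[n+t]≡-t (+ order) (A k))

  a∞≡-B : a∞ F P Q ≡ - B
  a∞≡-B = trans (cong (_-_ (+ order)) (#y²≡f (eval P))) (n-[n+t]≡-t (+ order) B)

  square-neg : ∀ {s} t → s ≡ - t → s * s ≡ t * t
  square-neg t refl = solve 1 (λ t → :- t :* :- t := t :* t) refl t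
    where open +-*-Solver

  M̃₂≡∑A²+B² : M̃₂ F P Q ≡ ∑[ k ∈ elements ] (A k * A k) + B * B
  M̃₂≡∑A²+B² =
    cong₂ _+_ (∑-cong elements (λ k → square-neg (A k) (a≡-A k))) (square-neg B a∞≡-B)

  #Maff≡ : + #Maff F P Q ≡ + order * (+ order * + order) + ∑[ k ∈ elements ] (A k * A k)
  #Maff≡ = begin
    + #Maff F P Q
      ≡⟨ trans (count-as-∑ (cartesianProduct pairs pairs) _ _) (∑-cartesianProduct pairs pairs _) ⟩
    ∑[ x ∈ pairs ] ∑[ ky ∈ pairs ]
      𝟙 (fibre (proj₁ ky) (proj₁ x) · fibre (proj₁ ky) (proj₂ x) ≟ proj₂ ky · proj₂ ky)
      ≡⟨ ∑-cong pairs (λ x → ∑-pairs _) ⟩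
    ∑[ x ∈ pairs ] ∑[ k ∈ elements ] ∑[ y ∈ elements ]
      𝟙 (fibre k (proj₁ x) · fibre k (proj₂ x) ≟ y · y)
      ≡⟨ ∑-swap pairs elements _ ⟩
    ∑[ k ∈ elements ] ∑[ x ∈ pairs ] ∑[ y ∈ elements ]
      𝟙 (fibre k (proj₁ x) · fibre k (proj₂ x) ≟ y · y)
      ≡⟨ ∑-cong elements (λ k → trans (∑-pairs _) (#g₁g₂≡y² (fibre k))) ⟩
    ∑[ k ∈ elements ] (+ order * + order + A k * A k)
      ≡⟨ ∑-+ elements _ _ ⟩
    ∑[ k ∈ elements ] (+ order * + order) + ∑[ k ∈ elements ] (A k * A k)
      ≡⟨ cong (_+ ∑[ k ∈ elements ] (A k * A k)) (∑-const elements _) ⟩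
    + order * (+ order * + order) + ∑[ k ∈ elements ] (A k * A k)
      ∎
    where open ≡-Reasoning

  #M∞≡ : + #M∞ F P Q ≡ + order * + order + B * B
  #M∞≡ = begin
    + #M∞ F P Q
      ≡⟨ trans (count-as-∑ (cartesianProduct pairs elements) _ _)
               (∑-cartesianProduct pairs elements _) ⟩
    ∑[ x ∈ pairs ] ∑[ y ∈ elements ] 𝟙 (eval P (proj₁ x) · eval P (proj₂ x) ≟ y · y)
      ≡⟨ ∑-pairs _ ⟩
    ∑[ x₁ ∈ elements ] ∑[ x₂ ∈ elements ] ∑[ y ∈ elements ]
      𝟙 (eval P x₁ · eval P x₂ ≟ y · y)
      ≡⟨ #g₁g₂≡y² (eval P) ⟩
    + order * + order + B * B
      ∎
    where open ≡-Reasoning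

pos-^ : ∀ m k → + (m ^ k) ≡ (+ m) ℤ.^ k
pos-^ m ℕ.zero    = refl
pos-^ m (ℕ.suc k) = trans (ℤ.pos-* m (m ^ k)) (cong (_*_ (+ m)) (pos-^ m k))

theorem2p2 : (P Q : List ℤ) → DegLe P 3 → DegLe Q 3 → (F : FiniteField) →
    + (#M F P Q) ≡ + (FiniteField.order F ^ 3) + + (FiniteField.order F ^ 2) + M̃₂ F P Q
theorem2p2 P Q _ _ F = begin
  + (#Maff F P Q ℕ.+ #M∞ F P Q)
    ≡⟨ ℤ.pos-+ (#Maff F P Q) (#M∞ F P Q) ⟩
  + #Maff F P Q + + #M∞ F P Q
    ≡⟨ cong₂ _+_ #Maff≡ #M∞≡ ⟩
  (n * (n * n) + ∑A²) + (n * n + B * B)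
    ≡⟨ solve 3 (λ n a b → (n :* (n :* n) :+ a) :+ (n :* n :+ b)
                           := n :* (n :* (n :* con 1ℤ)) :+ n :* (n :* con 1ℤ) :+ (a :+ b))
               refl n ∑A² (B * B) ⟩
  n ℤ.^ 3 + n ℤ.^ 2 + (∑A² + B * B)
    ≡⟨ cong₂ _+_ (cong₂ _+_ (pos-^ order 3) (pos-^ order 2)) M̃₂≡∑A²+B² ⟨
  + (order ^ 3) + + (order ^ 2) + M̃₂ F P Q
    ∎
  where
  open FiniteField F using (order; elements)
  open Threefold F P Q
  open ≡-Reasoning
  open +-*-Solver
  n ∑A² : ℤ
  n = + order
  ∑A² = ∑[ k ∈ elements ] (A k * A k)
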